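{- Let $n\ge 1$ and let $R_{n,k}$ ($0\le k\le n$) denote the effective resistance between two vertices at Hamming distance $k$ in the $n$-dimensional hypercube graph $Q_n$ (vertex set $\{0,1\}^n$, edges between vertices differing in exactly one coordinate) in which every edge is a $1$-ohm resistor. Then $R_{n,k}$ is strictly increasing in $k$: $R_{n,k} - R_{n,k-1} > 0$ for $1\le k\le n$; in fact $$R_{n,k}-R_{n,k-1} = \frac{1}{n\,2^{n-1}}\cdot\frac{1}{\binom{n-1}{k-1}}\sum_{i=k}^{n}\binom{n}{i}.$$
   Context: Effective resistance between vertices $u,v$: the potential difference between $u$ and $v$ when a unit current is injected at $u$ and extracted at $v$. $R_{n,0}=0$. -}

module Defs where

open import Data.Bool using (Bool; true; false; not; if_then_else_; _xor_)
open import Data.Bool.Properties using () renaming (_≟_ to _≟B_)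
open import Data.Nat using (ℕ; zero; suc; _+_; _*_; _∸_; _^_)
open import Data.Nat.Combinatorics using (_C_)
open import Data.Fin using (Fin)
open import Data.Vec using (Vec; []; _∷_; updateAt)
open import Data.Vec.Properties using (≡-dec)
open import Data.List using (List; map; foldr; upTo)
open import Data.Nat.ListAction using (sum)
open import Data.Integer using (+_)
open import Data.List using () renaming (allFin to allFinL)
open import Data.Rational using (ℚ; 0ℚ; 1ℚ; _/_) renaming (_+_ to _+ℚ_; _-_ to _-ℚ_)
open import Data.Product using (Σ; _×_)
open import Relation.Nullary.Decidable using (⌊_⌋)
open import Relation.Binary.PropositionalEquality using (_≡_)

Vertex : ℕ → Set
Vertex n = Vec Bool n

flipAt : {n : ℕ} → Vertex n → Fin n → Vertex n
flipAt w i = updateAt w i not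

hamming : {n : ℕ} → Vertex n → Vertex n → ℕ
hamming [] [] = 0
hamming (x ∷ xs) (y ∷ ys) = (if x xor y then 1 else 0) + hamming xs ys

sumℚ : List ℚ → ℚ
sumℚ = foldr _+ℚ_ 0ℚ

-- Net current flowing out of w into the network (all edges 1 ohm):
-- sum over neighbours x of (φ w - φ x).
outCurrent : {n : ℕ} → (Vertex n → ℚ) → Vertex n → ℚ
outCurrent {n} φ w = sumℚ (map (λ i → φ w -ℚ φ (flipAt w i)) (allFinL n))

indicator : {n : ℕ} → Vertex n → Vertex n → ℚ
indicator w u = if ⌊ ≡-dec _≟B_ w u ⌋ then 1ℚ else 0ℚ

-- φ is a potential for a unit current injected at u and extracted at v
-- (Kirchhoff's current law + Ohm's law at every vertex).
IsUnitFlowPotential : (n : ℕ) → Vertex n → Vertex n → (Vertex n → ℚ) → Set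
IsUnitFlowPotential n u v φ =
  (w : Vertex n) → outCurrent φ w ≡ indicator w u -ℚ indicator w v

IsEffRes : (n : ℕ) → Vertex n → Vertex n → ℚ → Set
IsEffRes n u v r = Σ (Vertex n → ℚ) λ φ → IsUnitFlowPotential n u v φ × (r ≡ φ u -ℚ φ v)

tailBinomSum : ℕ → ℕ → ℕ
tailBinomSum n k = sum (map (λ j → n C (k + j)) (upTo (suc n ∸ k)))

diffDenominator : ℕ → ℕ → ℕ
diffDenominator n k = n * 2 ^ (n ∸ 1) * ((n ∸ 1) C (k ∸ 1))

ℕ→ℚ : ℕ → ℚ
ℕ→ℚ m = (+ m) / 1

module Submission where

-- Effective resistance is well defined because the pairing ℰ ψ φ = Σ_w ψ(w)·(Δφ)(w) is symmetric: if
-- Δφ = Δψ = δ_u − δ_v then φ u − φ v = ℰ φ ψ = ℰ ψ φ = ψ u − ψ v. For existence, the radial function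
-- Q(d(·,u)) with increments g j = T(n,j+1) / (2ⁿ·n·C(n−1,j)), where T(n,k) = Σ_{i≥k} C(n,i), satisfies
-- Δ = 2⁻ⁿ − δ_u (the absorption identities k·C(n,k) = n·C(n−1,k−1) do the bookkeeping), so
-- Q(d(·,v)) − Q(d(·,u)) is a unit-flow potential from u to v. Hence R_{n,k} = 2Q(k), and
-- R_{n,k} − R_{n,k−1} = 2g(k−1) is the stated positive quotient.

open import Algebra.Bundles using (CommutativeRing)
open import Data.Bool using (true; false)
open import Data.Bool.Properties using (not-involutive) renaming (_≟_ to _≟B_)
open import Data.Empty using (⊥-elim)
open import Data.Fin using (Fin) renaming (zero to fzero; suc to fsuc)
import Data.Integer as ℤ
import Data.Integer.Properties as ℤ
open import Data.List using (applyUpTo; tabulate)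
open import Data.List.Properties using (map-applyUpTo; map-tabulate)
open import Data.Nat.Combinatorics using (_C_)
open import Data.Nat.Coprimality using (1-coprimeTo) renaming (sym to coprime-sym)
open import Data.Product using (Σ; _×_; _,_)
open import Data.Vec using ([]; _∷_)
open import Data.Vec.Properties using (≡-dec)
open import Function using (_∘_)
open import Relation.Binary.PropositionalEquality
open import Relation.Nullary using (yes; no)

open import Defs

open ≡-Reasoning

module BinomialCoefficients where
  open import Data.Nat
  open import Data.Nat.Combinatorics using (nCk+nC[k+1]≡[n+1]C[k+1])
  open import Data.Nat.ListAction using (sum)
  open import Data.Nat.Properties
  open import Algebra.Properties.CommutativeSemigroup +-commutativeSemigroup
    using () renaming (interchange to +-interchange)
  open import Data.Nat.Solver using (module +-*-Solver)
  open +-*-Solver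

  m*n>0 : ∀ {m n} → 0 < m → 0 < n → 0 < m * n
  m*n>0 = *-mono-≤

  binomial : ℕ → ℕ → ℕ
  binomial n       zero    = 1
  binomial zero    (suc k) = 0
  binomial (suc n) (suc k) = binomial n k + binomial n (suc k)

  binomial≡C : ∀ n k → binomial n k ≡ n C k
  binomial≡C n       zero    = refl
  binomial≡C zero    (suc k) = refl
  binomial≡C (suc n) (suc k) =
    trans (cong₂ _+_ (binomial≡C n k) (binomial≡C n (suc k))) (nCk+nC[k+1]≡[n+1]C[k+1] n k)

  binomial>0 : ∀ {n k} → k ≤ n → 0 < binomial n k
  binomial>0 {k = zero}  _         = s≤s z≤n
  binomial>0 {suc n} {suc k} (s≤s k≤n) = ≤-trans (binomial>0 k≤n) (m≤m+n _ _)

  binomial-1 : ∀ n → binomial n 1 ≡ n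
  binomial-1 zero    = refl
  binomial-1 (suc n) = cong suc (binomial-1 n)

  suc-*-binomial : ∀ n k → suc k * binomial (suc n) (suc k) ≡ suc n * binomial n k
  suc-*-binomial zero    zero    = refl
  suc-*-binomial zero    (suc k) = *-zeroʳ (suc (suc k))
  suc-*-binomial (suc n) zero    =
    trans (+-identityʳ _) (trans (binomial-1 (suc (suc n))) (sym (*-identityʳ (suc (suc n)))))
  suc-*-binomial (suc n) (suc k) = begin
    suc (suc k) * (X + Y)
      ≡⟨ solve 3 (λ k X Y → (con 2 :+ k) :* (X :+ Y) := ((con 1 :+ k) :* X :+ X) :+ (con 2 :+ k) :* Y) refl k X Y ⟩
    (suc k * X + X) + suc (suc k) * Y
      ≡⟨ cong₂ (λ p q → (p + X) + q) (suc-*-binomial n k) (suc-*-binomial n (suc k)) ⟩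
    (suc n * a + X) + suc n * b
      ≡⟨ solve 3 (λ n a b → ((con 1 :+ n) :* a :+ (a :+ b)) :+ (con 1 :+ n) :* b := (con 2 :+ n) :* (a :+ b)) refl n a b ⟩
    suc (suc n) * X ∎
    where
    a = binomial n k
    b = binomial n (suc k)
    X = binomial (suc n) (suc k)
    Y = binomial (suc n) (suc (suc k))

  ∸-*-binomial : ∀ {n k} → k ≤ n → (n ∸ k) * binomial (suc n) (suc k) ≡ suc n * binomial n (suc k)
  ∸-*-binomial {n} {k} k≤n = +-cancelˡ-≡ (suc n * binomial n k) _ _ (begin
    suc n * binomial n k + (n ∸ k) * B ≡⟨ cong (_+ (n ∸ k) * B) (suc-*-binomial n k) ⟨
    suc k * B + (n ∸ k) * B            ≡⟨ *-distribʳ-+ B (suc k) (n ∸ k) ⟨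
    (suc k + (n ∸ k)) * B              ≡⟨ cong (λ z → suc z * B) (m+[n∸m]≡n k≤n) ⟩
    suc n * B                          ≡⟨ *-distribˡ-+ (suc n) (binomial n k) (binomial n (suc k)) ⟩
    suc n * binomial n k + suc n * binomial n (suc k) ∎)
    where B = binomial (suc n) (suc k)

  sum-applyUpTo-cong : ∀ {f g} L → (∀ j → f j ≡ g j) → sum (applyUpTo f L) ≡ sum (applyUpTo g L)
  sum-applyUpTo-cong zero    f≗g = refl
  sum-applyUpTo-cong (suc L) f≗g = cong₂ _+_ (f≗g 0) (sum-applyUpTo-cong L (f≗g ∘ suc))

  sum-applyUpTo-+ : ∀ f g L →
    sum (applyUpTo (λ j → f j + g j) L) ≡ sum (applyUpTo f L) + sum (applyUpTo g L)
  sum-applyUpTo-+ f g zero    = refl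
  sum-applyUpTo-+ f g (suc L) =
    trans (cong ((f 0 + g 0) +_) (sum-applyUpTo-+ (f ∘ suc) (g ∘ suc) L))
          (+-interchange (f 0) (g 0) _ _)

  sum-applyUpTo-0 : ∀ L → sum (applyUpTo (λ _ → 0) L) ≡ 0
  sum-applyUpTo-0 zero    = refl
  sum-applyUpTo-0 (suc L) = sum-applyUpTo-0 L

  sum-binomial : ∀ {n L} → n < L → sum (applyUpTo (binomial n) L) ≡ 2 ^ n
  sum-binomial {zero}  {suc L} _ = cong suc (sum-applyUpTo-0 L)
  sum-binomial {suc n} {suc (suc L)} (s≤s n<1+L) = begin
    1 + sum (applyUpTo (λ j → binomial n j + binomial n (suc j)) (suc L))
      ≡⟨ cong suc (sum-applyUpTo-+ (binomial n) (binomial n ∘ suc) (suc L)) ⟩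
    1 + (sum (applyUpTo (binomial n) (suc L)) + sum (applyUpTo (binomial n ∘ suc) (suc L)))
      ≡⟨ cong suc (+-comm (sum (applyUpTo (binomial n) (suc L))) _) ⟩
    sum (applyUpTo (binomial n) (suc (suc L))) + sum (applyUpTo (binomial n) (suc L))
      ≡⟨ cong₂ _+_ (sum-binomial (m<n⇒m<1+n n<1+L)) (sum-binomial n<1+L) ⟩
    2 ^ n + 2 ^ n
      ≡⟨ cong (2 ^ n +_) (+-identityʳ (2 ^ n)) ⟨
    2 ^ suc n ∎

  binomialTail : ℕ → ℕ → ℕ
  binomialTail n k = sum (applyUpTo (λ j → binomial n (k + j)) (suc n ∸ k))

  tailBinomSum≡binomialTail : ∀ n k → tailBinomSum n k ≡ binomialTail n k
  tailBinomSum≡binomialTail n k = trans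
    (cong sum (map-applyUpTo (λ j → j) (λ j → n C (k + j)) (suc n ∸ k)))
    (sum-applyUpTo-cong (suc n ∸ k) (λ j → sym (binomial≡C n (k + j))))

  binomialTail-0 : ∀ n → binomialTail n 0 ≡ 2 ^ n
  binomialTail-0 n = sum-binomial (n<1+n n)

  binomialTail-suc : ∀ {n k} → k ≤ n → binomialTail n k ≡ binomial n k + binomialTail n (suc k)
  binomialTail-suc {n} {k} k≤n rewrite +-∸-assoc 1 k≤n = cong₂ _+_
    (cong (binomial n) (+-identityʳ k))
    (sum-applyUpTo-cong (n ∸ k) (λ j → cong (binomial n) (+-suc k j)))

  binomialTail-> : ∀ {n k} → n < k → binomialTail n k ≡ 0
  binomialTail-> {n} {k} n<k rewrite m≤n⇒m∸n≡0 n<k = refl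

  binomialTail>0 : ∀ {n k} → k ≤ n → 0 < binomialTail n k
  binomialTail>0 k≤n rewrite binomialTail-suc k≤n = ≤-trans (binomial>0 k≤n) (m≤m+n _ _)

open BinomialCoefficients

open import Data.Nat as ℕ using (ℕ; zero; suc; pred; _^_; z≤n; s≤s)
import Data.Nat.Properties as ℕ
open import Data.Rational
open import Data.Rational.Properties
open import Data.Rational.Solver using (module +-*-Solver)
open +-*-Solver
open import Algebra.Properties.Ring +-*-ring using (x[y-z]≈xy-xz)
open import Algebra.Properties.Semiring.Sum (CommutativeRing.semiring +-*-commutativeRing)
  using (sum; sum-syntax; sum-cong-≗; *-distribˡ-sum)

-- ℕ→ℚ m is stuck on a variable m (it normalises (+ m)/1 through a gcd); this form reduces, as 1/_ needs.
ℕ→ℚⁿᶠ : ℕ → ℚ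
ℕ→ℚⁿᶠ m = mkℚ (ℤ.+ m) 0 (coprime-sym (1-coprimeTo m))

ℕ→ℚ≡ℕ→ℚⁿᶠ : ∀ m → ℕ→ℚ m ≡ ℕ→ℚⁿᶠ m
ℕ→ℚ≡ℕ→ℚⁿᶠ m = normalize-coprime _

ℕ→ℚ-suc : ∀ m → ℕ→ℚ (suc m) ≡ 1ℚ + ℕ→ℚ m
ℕ→ℚ-suc m = sym (trans (cong (1ℚ +_) (ℕ→ℚ≡ℕ→ℚⁿᶠ m))
  (/-cong {p₁ = ℤ.1ℤ ℤ.+ ℤ.+ m ℤ.* ℤ.1ℤ} (cong (ℤ._+_ ℤ.1ℤ) (ℤ.*-identityʳ (ℤ.+ m))) refl))

ℕ→ℚ-+ : ∀ a b → ℕ→ℚ (a ℕ.+ b) ≡ ℕ→ℚ a + ℕ→ℚ b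
ℕ→ℚ-+ zero    b = sym (+-identityˡ (ℕ→ℚ b))
ℕ→ℚ-+ (suc a) b = begin
  ℕ→ℚ (suc (a ℕ.+ b))     ≡⟨ ℕ→ℚ-suc (a ℕ.+ b) ⟩
  1ℚ + ℕ→ℚ (a ℕ.+ b)      ≡⟨ cong (1ℚ +_) (ℕ→ℚ-+ a b) ⟩
  1ℚ + (ℕ→ℚ a + ℕ→ℚ b)    ≡⟨ +-assoc 1ℚ (ℕ→ℚ a) (ℕ→ℚ b) ⟨
  (1ℚ + ℕ→ℚ a) + ℕ→ℚ b    ≡⟨ cong (_+ ℕ→ℚ b) (ℕ→ℚ-suc a) ⟨
  ℕ→ℚ (suc a) + ℕ→ℚ b     ∎

ℕ→ℚ-* : ∀ a b → ℕ→ℚ (a ℕ.* b) ≡ ℕ→ℚ a * ℕ→ℚ b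
ℕ→ℚ-* zero    b = sym (*-zeroˡ (ℕ→ℚ b))
ℕ→ℚ-* (suc a) b = begin
  ℕ→ℚ (b ℕ.+ a ℕ.* b)        ≡⟨ ℕ→ℚ-+ b (a ℕ.* b) ⟩
  ℕ→ℚ b + ℕ→ℚ (a ℕ.* b)      ≡⟨ cong (ℕ→ℚ b +_) (ℕ→ℚ-* a b) ⟩
  ℕ→ℚ b + ℕ→ℚ a * ℕ→ℚ b      ≡⟨ solve 2 (λ x y → y :+ x :* y := (con 1ℚ :+ x) :* y) refl (ℕ→ℚ a) (ℕ→ℚ b) ⟩
  (1ℚ + ℕ→ℚ a) * ℕ→ℚ b       ≡⟨ cong (_* ℕ→ℚ b) (ℕ→ℚ-suc a) ⟨
  ℕ→ℚ (suc a) * ℕ→ℚ b        ∎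

-- Junk value: recip 0 = 0, so lemmas about _÷ℕ_ carry positivity hypotheses on the divisor.
recip : ℕ → ℚ
recip zero    = 0ℚ
recip (suc m) = 1/ ℕ→ℚⁿᶠ (suc m)

infixl 7 _÷ℕ_

_÷ℕ_ : ℕ → ℕ → ℚ
a ÷ℕ Y = ℕ→ℚ a * recip Y

ℕ→ℚ-*-recip : ∀ {Y} → 0 ℕ.< Y → ℕ→ℚ Y * recip Y ≡ 1ℚ
ℕ→ℚ-*-recip {suc Y} _ = trans (cong (_* recip (suc Y)) (ℕ→ℚ≡ℕ→ℚⁿᶠ (suc Y))) (*-inverseʳ (ℕ→ℚⁿᶠ (suc Y)))

÷ℕ-*-cancel : ∀ a {Y} → 0 ℕ.< Y → (a ÷ℕ Y) * ℕ→ℚ Y ≡ ℕ→ℚ a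
÷ℕ-*-cancel a {Y} 0<Y = begin
  (ℕ→ℚ a * recip Y) * ℕ→ℚ Y   ≡⟨ solve 3 (λ x r y → (x :* r) :* y := x :* (y :* r)) refl (ℕ→ℚ a) (recip Y) (ℕ→ℚ Y) ⟩
  ℕ→ℚ a * (ℕ→ℚ Y * recip Y)   ≡⟨ cong (ℕ→ℚ a *_) (ℕ→ℚ-*-recip 0<Y) ⟩
  ℕ→ℚ a * 1ℚ                   ≡⟨ *-identityʳ (ℕ→ℚ a) ⟩
  ℕ→ℚ a                        ∎

÷ℕ-unique : ∀ {x} a {Y} → 0 ℕ.< Y → x * ℕ→ℚ Y ≡ ℕ→ℚ a → x ≡ a ÷ℕ Y
÷ℕ-unique {x} a {Y} 0<Y xY≡a = begin
  x                          ≡⟨ *-identityʳ x ⟨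
  x * 1ℚ                     ≡⟨ cong (x *_) (ℕ→ℚ-*-recip 0<Y) ⟨
  x * (ℕ→ℚ Y * recip Y)      ≡⟨ *-assoc x (ℕ→ℚ Y) (recip Y) ⟨
  (x * ℕ→ℚ Y) * recip Y      ≡⟨ cong (_* recip Y) xY≡a ⟩
  a ÷ℕ Y                     ∎

*-÷ℕ : ∀ c a {X Y} → 0 ℕ.< c → 0 ℕ.< Y → X ≡ c ℕ.* Y → ℕ→ℚ c * (a ÷ℕ X) ≡ a ÷ℕ Y
*-÷ℕ c a {X} {Y} 0<c 0<Y refl = ÷ℕ-unique a 0<Y (begin
  (ℕ→ℚ c * (a ÷ℕ X)) * ℕ→ℚ Y  ≡⟨ solve 3 (λ c q y → (c :* q) :* y := q :* (c :* y)) refl (ℕ→ℚ c) (a ÷ℕ X) (ℕ→ℚ Y) ⟩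
  (a ÷ℕ X) * (ℕ→ℚ c * ℕ→ℚ Y)  ≡⟨ cong ((a ÷ℕ X) *_) (ℕ→ℚ-* c Y) ⟨
  (a ÷ℕ X) * ℕ→ℚ X            ≡⟨ ÷ℕ-*-cancel a (m*n>0 0<c 0<Y) ⟩
  ℕ→ℚ a                       ∎)

÷ℕ>0 : ∀ {a Y} → 0 ℕ.< a → 0 ℕ.< Y → 0ℚ < a ÷ℕ Y
÷ℕ>0 {suc a} {suc Y} _ _ = positive⁻¹ _ {{pos*pos⇒pos (ℕ→ℚ (suc a)) {{ℕ→ℚ[1+a]>0}} (recip (suc Y))}}
  where
  ℕ→ℚ[1+a]>0 : Positive (ℕ→ℚ (suc a))
  ℕ→ℚ[1+a]>0 = subst Positive (sym (ℕ→ℚ≡ℕ→ℚⁿᶠ (suc a))) _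

sumℚ-tabulate : ∀ {n} (f : Fin n → ℚ) → sumℚ (tabulate f) ≡ sum f
sumℚ-tabulate {zero}  f = refl
sumℚ-tabulate {suc n} f = cong (f fzero +_) (sumℚ-tabulate (f ∘ fsuc))

∑-distrib-- : ∀ {n} (f g : Fin n → ℚ) → ∑[ i < n ] (f i - g i) ≡ ∑[ i < n ] f i - ∑[ i < n ] g i
∑-distrib-- {zero}  f g = refl
∑-distrib-- {suc n} f g = trans (cong ((f fzero - g fzero) +_) (∑-distrib-- (f ∘ fsuc) (g ∘ fsuc)))
  (solve 4 (λ a b c d → (a :- b) :+ (c :- d) := (a :+ c) :- (b :+ d)) refl
    (f fzero) (g fzero) (sum (f ∘ fsuc)) (sum (g ∘ fsuc)))

∑-const : ∀ n x → ∑[ i < n ] x ≡ ℕ→ℚ n * x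
∑-const zero    x = sym (*-zeroˡ x)
∑-const (suc n) x = begin
  x + ∑[ i < n ] x       ≡⟨ cong (x +_) (∑-const n x) ⟩
  x + ℕ→ℚ n * x          ≡⟨ solve 2 (λ x a → x :+ a :* x := (con 1ℚ :+ a) :* x) refl x (ℕ→ℚ n) ⟩
  (1ℚ + ℕ→ℚ n) * x       ≡⟨ cong (_* x) (ℕ→ℚ-suc n) ⟨
  ℕ→ℚ (suc n) * x        ∎

∑ᵥ : ∀ n → (Vertex n → ℚ) → ℚ
∑ᵥ zero    F = F []
∑ᵥ (suc n) F = ∑ᵥ n (F ∘ (true ∷_)) + ∑ᵥ n (F ∘ (false ∷_))

∑ᵥ-cong : ∀ n {F G : Vertex n → ℚ} → (∀ w → F w ≡ G w) → ∑ᵥ n F ≡ ∑ᵥ n G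
∑ᵥ-cong zero    F≗G = F≗G []
∑ᵥ-cong (suc n) F≗G = cong₂ _+_ (∑ᵥ-cong n (F≗G ∘ (true ∷_))) (∑ᵥ-cong n (F≗G ∘ (false ∷_)))

∑ᵥ-0 : ∀ n {F : Vertex n → ℚ} → (∀ w → F w ≡ 0ℚ) → ∑ᵥ n F ≡ 0ℚ
∑ᵥ-0 zero    F≗0 = F≗0 []
∑ᵥ-0 (suc n) F≗0 = cong₂ _+_ (∑ᵥ-0 n (F≗0 ∘ (true ∷_))) (∑ᵥ-0 n (F≗0 ∘ (false ∷_)))

∑ᵥ-distrib-+ : ∀ n (F G : Vertex n → ℚ) → ∑ᵥ n (λ w → F w + G w) ≡ ∑ᵥ n F + ∑ᵥ n G
∑ᵥ-distrib-+ zero    F G = refl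
∑ᵥ-distrib-+ (suc n) F G = trans
  (cong₂ _+_ (∑ᵥ-distrib-+ n (F ∘ (true ∷_)) (G ∘ (true ∷_))) (∑ᵥ-distrib-+ n (F ∘ (false ∷_)) (G ∘ (false ∷_))))
  (solve 4 (λ a b c d → (a :+ b) :+ (c :+ d) := (a :+ c) :+ (b :+ d)) refl
    (∑ᵥ n (F ∘ (true ∷_))) (∑ᵥ n (G ∘ (true ∷_))) (∑ᵥ n (F ∘ (false ∷_))) (∑ᵥ n (G ∘ (false ∷_))))

∑ᵥ-distrib-- : ∀ n (F G : Vertex n → ℚ) → ∑ᵥ n (λ w → F w - G w) ≡ ∑ᵥ n F - ∑ᵥ n G
∑ᵥ-distrib-- zero    F G = refl
∑ᵥ-distrib-- (suc n) F G = trans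
  (cong₂ _+_ (∑ᵥ-distrib-- n (F ∘ (true ∷_)) (G ∘ (true ∷_))) (∑ᵥ-distrib-- n (F ∘ (false ∷_)) (G ∘ (false ∷_))))
  (solve 4 (λ a b c d → (a :- b) :+ (c :- d) := (a :+ c) :- (b :+ d)) refl
    (∑ᵥ n (F ∘ (true ∷_))) (∑ᵥ n (G ∘ (true ∷_))) (∑ᵥ n (F ∘ (false ∷_))) (∑ᵥ n (G ∘ (false ∷_))))

∑ᵥ-∑-comm : ∀ n k (H : Vertex n → Fin k → ℚ) → ∑ᵥ n (λ w → ∑[ i < k ] H w i) ≡ ∑[ i < k ] ∑ᵥ n (λ w → H w i)
∑ᵥ-∑-comm n zero    H = ∑ᵥ-0 n (λ _ → refl)
∑ᵥ-∑-comm n (suc k) H = trans (∑ᵥ-distrib-+ n (λ w → H w fzero) (λ w → ∑[ i < k ] H w (fsuc i)))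
  (cong (∑ᵥ n (λ w → H w fzero) +_) (∑ᵥ-∑-comm n k (λ w i → H w (fsuc i))))

∑ᵥ-flipAt : ∀ n (i : Fin n) (F : Vertex n → ℚ) → ∑ᵥ n (λ w → F (flipAt w i)) ≡ ∑ᵥ n F
∑ᵥ-flipAt (suc n) fzero    F = +-comm (∑ᵥ n (F ∘ (false ∷_))) (∑ᵥ n (F ∘ (true ∷_)))
∑ᵥ-flipAt (suc n) (fsuc i) F = cong₂ _+_ (∑ᵥ-flipAt n i (F ∘ (true ∷_))) (∑ᵥ-flipAt n i (F ∘ (false ∷_)))

flipAt-involutive : ∀ {n} (w : Vertex n) i → flipAt (flipAt w i) i ≡ w
flipAt-involutive (b ∷ w) fzero    = cong (_∷ w) (not-involutive b)
flipAt-involutive (b ∷ w) (fsuc i) = cong (b ∷_) (flipAt-involutive w i)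

hamming-refl : ∀ {n} (w : Vertex n) → hamming w w ≡ 0
hamming-refl []          = refl
hamming-refl (true ∷ w)  = hamming-refl w
hamming-refl (false ∷ w) = hamming-refl w

hamming-sym : ∀ {n} (w u : Vertex n) → hamming w u ≡ hamming u w
hamming-sym []          []          = refl
hamming-sym (true ∷ w)  (true ∷ u)  = hamming-sym w u
hamming-sym (true ∷ w)  (false ∷ u) = cong suc (hamming-sym w u)
hamming-sym (false ∷ w) (true ∷ u)  = cong suc (hamming-sym w u)
hamming-sym (false ∷ w) (false ∷ u) = hamming-sym w u

hamming≡0⇒≡ : ∀ {n} (w u : Vertex n) → hamming w u ≡ 0 → w ≡ u
hamming≡0⇒≡ []          []          _  = refl
hamming≡0⇒≡ (true ∷ w)  (true ∷ u)  eq = cong (true ∷_) (hamming≡0⇒≡ w u eq)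
hamming≡0⇒≡ (false ∷ w) (false ∷ u) eq = cong (false ∷_) (hamming≡0⇒≡ w u eq)

hamming-≤ : ∀ {n} (w u : Vertex n) → hamming w u ℕ.≤ n
hamming-≤ []          []          = z≤n
hamming-≤ (true ∷ w)  (true ∷ u)  = ℕ.m≤n⇒m≤1+n (hamming-≤ w u)
hamming-≤ (true ∷ w)  (false ∷ u) = s≤s (hamming-≤ w u)
hamming-≤ (false ∷ w) (true ∷ u)  = s≤s (hamming-≤ w u)
hamming-≤ (false ∷ w) (false ∷ u) = ℕ.m≤n⇒m≤1+n (hamming-≤ w u)

δ₀ : ℕ → ℚ
δ₀ zero    = 1ℚ
δ₀ (suc _) = 0ℚ

indicator≡δ₀∘hamming : ∀ {n} (w u : Vertex n) → indicator w u ≡ δ₀ (hamming w u)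
indicator≡δ₀∘hamming w u with ≡-dec _≟B_ w u
... | yes refl rewrite hamming-refl w = refl
... | no w≢u with hamming w u in eq
...   | zero  = ⊥-elim (w≢u (hamming≡0⇒≡ w u eq))
...   | suc _ = refl

∑ᵥ-δ₀∘hamming : ∀ n (G : Vertex n → ℚ) u → ∑ᵥ n (λ w → G w * δ₀ (hamming w u)) ≡ G u
∑ᵥ-δ₀∘hamming zero    G []          = *-identityʳ (G [])
∑ᵥ-δ₀∘hamming (suc n) G (true ∷ u)  = trans
  (cong₂ _+_ (∑ᵥ-δ₀∘hamming n (G ∘ (true ∷_)) u) (∑ᵥ-0 n (λ w → *-zeroʳ (G (false ∷ w)))))
  (+-identityʳ (G (true ∷ u)))
∑ᵥ-δ₀∘hamming (suc n) G (false ∷ u) = trans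
  (cong₂ _+_ (∑ᵥ-0 n (λ w → *-zeroʳ (G (true ∷ w)))) (∑ᵥ-δ₀∘hamming n (G ∘ (false ∷_)) u))
  (+-identityˡ (G (false ∷ u)))

neighbourSum : ℕ → (ℕ → ℚ) → ℕ → ℚ
neighbourSum n h d = ℕ→ℚ d * h (pred d) + ℕ→ℚ (n ℕ.∸ d) * h (suc d)

neighbourSum-suc : ∀ {n d} (h : ℕ → ℚ) → d ℕ.≤ n →
  h (suc d) + neighbourSum n h d ≡ neighbourSum (suc n) h d
neighbourSum-suc {n} {d} h d≤n rewrite ℕ.+-∸-assoc 1 d≤n | ℕ→ℚ-suc (n ℕ.∸ d) =
  solve 4 (λ a b c x → x :+ (a :* b :+ c :* x) := a :* b :+ (con 1ℚ :+ c) :* x) refl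
    (ℕ→ℚ d) (h (pred d)) (ℕ→ℚ (n ℕ.∸ d)) (h (suc d))

neighbourSum-suc-suc : ∀ n d (h : ℕ → ℚ) →
  h d + neighbourSum n (h ∘ suc) d ≡ neighbourSum (suc n) h (suc d)
neighbourSum-suc-suc n zero    h =
  solve 4 (λ x z c y → x :+ (con 0ℚ :* z :+ c :* y) := con 1ℚ :* x :+ c :* y) refl (h 0) (h 1) (ℕ→ℚ n) (h 2)
neighbourSum-suc-suc n (suc d) h rewrite ℕ→ℚ-suc (suc d) =
  solve 4 (λ a x c y → x :+ (a :* x :+ c :* y) := (con 1ℚ :+ a) :* x :+ c :* y) refl
    (ℕ→ℚ (suc d)) (h (suc d)) (ℕ→ℚ (n ℕ.∸ suc d)) (h (suc (suc (suc d))))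

∑-flipAt-hamming : ∀ {n} (w u : Vertex n) (h : ℕ → ℚ) →
  ∑[ i < n ] h (hamming (flipAt w i) u) ≡ neighbourSum n h (hamming w u)
∑-flipAt-hamming []          []          h = solve 2 (λ a b → con 0ℚ := con 0ℚ :* a :+ con 0ℚ :* b) refl (h 0) (h 1)
∑-flipAt-hamming (true ∷ w)  (true ∷ u)  h =
  trans (cong (h (suc (hamming w u)) +_) (∑-flipAt-hamming w u h)) (neighbourSum-suc h (hamming-≤ w u))
∑-flipAt-hamming (false ∷ w) (false ∷ u) h =
  trans (cong (h (suc (hamming w u)) +_) (∑-flipAt-hamming w u h)) (neighbourSum-suc h (hamming-≤ w u))
∑-flipAt-hamming (true ∷ w)  (false ∷ u) h =
  trans (cong (h (hamming w u) +_) (∑-flipAt-hamming w u (h ∘ suc))) (neighbourSum-suc-suc _ (hamming w u) h)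
∑-flipAt-hamming (false ∷ w) (true ∷ u)  h =
  trans (cong (h (hamming w u) +_) (∑-flipAt-hamming w u (h ∘ suc))) (neighbourSum-suc-suc _ (hamming w u) h)

Δ : ∀ {n} → (Vertex n → ℚ) → Vertex n → ℚ
Δ {n} φ w = ∑[ i < n ] (φ w - φ (flipAt w i))

outCurrent≡Δ : ∀ {n} (φ : Vertex n → ℚ) w → outCurrent φ w ≡ Δ φ w
outCurrent≡Δ {n} φ w = trans (cong sumℚ (map-tabulate (λ i → i) (λ i → φ w - φ (flipAt w i))))
  (sumℚ-tabulate {n} (λ i → φ w - φ (flipAt w i)))

Δ-distrib-- : ∀ {n} (φ ψ : Vertex n → ℚ) w → Δ (λ x → φ x - ψ x) w ≡ Δ φ w - Δ ψ w
Δ-distrib-- {n} φ ψ w = trans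
  (sum-cong-≗ (λ i → solve 4 (λ a b c d → (a :- b) :- (c :- d) := (a :- c) :- (b :- d)) refl
    (φ w) (ψ w) (φ (flipAt w i)) (ψ (flipAt w i))))
  (∑-distrib-- (λ i → φ w - φ (flipAt w i)) (λ i → ψ w - ψ (flipAt w i)))

Δ-radial : ∀ {n} (h : ℕ → ℚ) (u w : Vertex n) →
  Δ (λ x → h (hamming x u)) w ≡ ℕ→ℚ n * h (hamming w u) - neighbourSum n h (hamming w u)
Δ-radial {n} h u w = trans (∑-distrib-- (λ _ → h (hamming w u)) (λ i → h (hamming (flipAt w i) u)))
  (cong₂ _-_ (∑-const n (h (hamming w u))) (∑-flipAt-hamming w u h))

ℰ : ∀ n → (Vertex n → ℚ) → (Vertex n → ℚ) → ℚ
ℰ n ψ φ = ∑ᵥ n (λ w → ψ w * Δ φ w)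

ℰ-expand : ∀ n (ψ φ : Vertex n → ℚ) →
  ℰ n ψ φ ≡ ∑[ i < n ] (∑ᵥ n (λ w → ψ w * φ w) - ∑ᵥ n (λ w → ψ w * φ (flipAt w i)))
ℰ-expand n ψ φ = begin
  ∑ᵥ n (λ w → ψ w * Δ φ w)
    ≡⟨ ∑ᵥ-cong n distribute ⟩
  ∑ᵥ n (λ w → ∑[ i < n ] (ψ w * φ w - ψ w * φ (flipAt w i)))
    ≡⟨ ∑ᵥ-∑-comm n n _ ⟩
  ∑[ i < n ] ∑ᵥ n (λ w → ψ w * φ w - ψ w * φ (flipAt w i))
    ≡⟨ sum-cong-≗ (λ i → ∑ᵥ-distrib-- n (λ w → ψ w * φ w) (λ w → ψ w * φ (flipAt w i))) ⟩
  ∑[ i < n ] (∑ᵥ n (λ w → ψ w * φ w) - ∑ᵥ n (λ w → ψ w * φ (flipAt w i))) ∎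
  where
  distribute : ∀ w → ψ w * Δ φ w ≡ ∑[ i < n ] (ψ w * φ w - ψ w * φ (flipAt w i))
  distribute w = trans (*-distribˡ-sum (ψ w) (λ i → φ w - φ (flipAt w i)))
    (sum-cong-≗ (λ i → x[y-z]≈xy-xz (ψ w) (φ w) (φ (flipAt w i))))

∑ᵥ-*-flipAt-comm : ∀ n i (ψ φ : Vertex n → ℚ) →
  ∑ᵥ n (λ w → ψ w * φ (flipAt w i)) ≡ ∑ᵥ n (λ w → φ w * ψ (flipAt w i))
∑ᵥ-*-flipAt-comm n i ψ φ = trans (sym (∑ᵥ-flipAt n i (λ w → ψ w * φ (flipAt w i))))
  (∑ᵥ-cong n (λ w → trans (cong (λ x → ψ (flipAt w i) * φ x) (flipAt-involutive w i))
                          (*-comm (ψ (flipAt w i)) (φ w))))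

ℰ-sym : ∀ n (ψ φ : Vertex n → ℚ) → ℰ n ψ φ ≡ ℰ n φ ψ
ℰ-sym n ψ φ = begin
  ℰ n ψ φ
    ≡⟨ ℰ-expand n ψ φ ⟩
  ∑[ i < n ] (∑ᵥ n (λ w → ψ w * φ w) - ∑ᵥ n (λ w → ψ w * φ (flipAt w i)))
    ≡⟨ sum-cong-≗ (λ i → cong₂ _-_ (∑ᵥ-cong n (λ w → *-comm (ψ w) (φ w))) (∑ᵥ-*-flipAt-comm n i ψ φ)) ⟩
  ∑[ i < n ] (∑ᵥ n (λ w → φ w * ψ w) - ∑ᵥ n (λ w → φ w * ψ (flipAt w i)))
    ≡⟨ ℰ-expand n φ ψ ⟨
  ℰ n φ ψ ∎

ℰ-unitFlow : ∀ {n u v} φ → IsUnitFlowPotential n u v φ → ∀ χ → ℰ n χ φ ≡ χ u - χ v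
ℰ-unitFlow {n} {u} {v} φ isφ χ = begin
  ∑ᵥ n (λ w → χ w * Δ φ w)
    ≡⟨ ∑ᵥ-cong n χ*kirchhoff ⟩
  ∑ᵥ n (λ w → χ w * δ₀ (hamming w u) - χ w * δ₀ (hamming w v))
    ≡⟨ ∑ᵥ-distrib-- n _ _ ⟩
  ∑ᵥ n (λ w → χ w * δ₀ (hamming w u)) - ∑ᵥ n (λ w → χ w * δ₀ (hamming w v))
    ≡⟨ cong₂ _-_ (∑ᵥ-δ₀∘hamming n χ u) (∑ᵥ-δ₀∘hamming n χ v) ⟩
  χ u - χ v ∎
  where
  χ*kirchhoff : ∀ w → χ w * Δ φ w ≡ χ w * δ₀ (hamming w u) - χ w * δ₀ (hamming w v)
  χ*kirchhoff w = trans (cong (χ w *_) (begin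
    Δ φ w                                  ≡⟨ outCurrent≡Δ φ w ⟨
    outCurrent φ w                         ≡⟨ isφ w ⟩
    indicator w u - indicator w v          ≡⟨ cong₂ _-_ (indicator≡δ₀∘hamming w u) (indicator≡δ₀∘hamming w v) ⟩
    δ₀ (hamming w u) - δ₀ (hamming w v)    ∎))
    (x[y-z]≈xy-xz (χ w) _ _)

isEffRes-unique : ∀ {n u v r r′} → IsEffRes n u v r → IsEffRes n u v r′ → r ≡ r′
isEffRes-unique {n} {u} {v} (φ , isφ , refl) (ψ , isψ , refl) = begin
  φ u - φ v   ≡⟨ ℰ-unitFlow ψ isψ φ ⟨
  ℰ n φ ψ     ≡⟨ ℰ-sym n φ ψ ⟩
  ℰ n ψ φ     ≡⟨ ℰ-unitFlow φ isφ ψ ⟩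
  ψ u - ψ v   ∎

module HypercubePotential (m : ℕ) where

  open import Algebra.Properties.CommutativeSemigroup ℕ.*-commutativeSemigroup using (x∙yz≈y∙xz)

  n N : ℕ
  n = suc m
  N = 2 ^ n

  -- Q d is the potential at distance d from a vertex absorbing the unit current that all vertices emit at
  -- 2⁻ⁿ each. The 2⁻ⁿ·T(n,j+1) emitted beyond distance j crosses the n·C(n−1,j) edges between distances
  -- j+1 and j equally, so each of them carries the potential drop g j.
  edges : ℕ → ℕ
  edges j = n ℕ.* binomial m j

  g : ℕ → ℚ
  g j = binomialTail n (suc j) ÷ℕ (N ℕ.* edges j)

  Q : ℕ → ℚ
  Q zero    = 0ℚ
  Q (suc j) = Q j + g j

  N>0 : 0 ℕ.< N
  N>0 = ℕ.m^n>0 2 n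

  N*edges>0 : ∀ {j} → j ℕ.≤ m → 0 ℕ.< N ℕ.* edges j
  N*edges>0 j≤m = m*n>0 N>0 (m*n>0 {n} (s≤s z≤n) (binomial>0 j≤m))

  g>0 : ∀ {j} → j ℕ.≤ m → 0ℚ < g j
  g>0 j≤m = ÷ℕ>0 (binomialTail>0 (s≤s j≤m)) (N*edges>0 j≤m)

  Q-kirchhoff-0 : ℕ→ℚ n * Q 0 - neighbourSum n Q 0 ≡ 1 ÷ℕ N - 1ℚ
  Q-kirchhoff-0 = begin
    ℕ→ℚ n * 0ℚ - (0ℚ * 0ℚ + ℕ→ℚ n * (0ℚ + g 0))
      ≡⟨ solve 2 (λ a x → a :* con 0ℚ :- (con 0ℚ :* con 0ℚ :+ a :* (con 0ℚ :+ x)) := :- (a :* x)) refl (ℕ→ℚ n) (g 0) ⟩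
    - (ℕ→ℚ n * g 0)
      ≡⟨ cong -_ (*-÷ℕ n T₁ (s≤s z≤n) N>0 (trans (cong (N ℕ.*_) (ℕ.*-identityʳ n)) (ℕ.*-comm N n))) ⟩
    - (ℕ→ℚ T₁ * recip N)
      ≡⟨ solve 2 (λ t r → :- (t :* r) := con 1ℚ :* r :- (con 1ℚ :+ t) :* r) refl (ℕ→ℚ T₁) (recip N) ⟩
    1 ÷ℕ N - (1ℚ + ℕ→ℚ T₁) * recip N
      ≡⟨ cong (λ x → 1 ÷ℕ N - x * recip N) (sym (ℕ→ℚ-suc T₁)) ⟩
    1 ÷ℕ N - suc T₁ ÷ℕ N
      ≡⟨ cong (λ x → 1 ÷ℕ N - x ÷ℕ N) (trans (sym (binomialTail-suc {n} z≤n)) (binomialTail-0 n)) ⟩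
    1 ÷ℕ N - N ÷ℕ N
      ≡⟨ cong (λ x → 1 ÷ℕ N - x) (ℕ→ℚ-*-recip N>0) ⟩
    1 ÷ℕ N - 1ℚ ∎
    where
    T₁ = binomialTail n 1

  module _ {e} (e≤m : e ℕ.≤ m) where

    B T₁ T₂ : ℕ
    B  = binomial n (suc e)
    T₁ = binomialTail n (suc e)
    T₂ = binomialTail n (suc (suc e))

    B>0 : 0 ℕ.< B
    B>0 = binomial>0 (s≤s e≤m)

    N*B>0 : 0 ℕ.< N ℕ.* B
    N*B>0 = m*n>0 N>0 B>0

    N*edges≡ : ∀ c j → edges j ≡ c ℕ.* B → N ℕ.* edges j ≡ c ℕ.* (N ℕ.* B)
    N*edges≡ c j eq = trans (cong (N ℕ.*_) eq) (x∙yz≈y∙xz N c B)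

    suc-*-g : ℕ→ℚ (suc e) * g e ≡ T₁ ÷ℕ (N ℕ.* B)
    suc-*-g = *-÷ℕ (suc e) T₁ (s≤s z≤n) N*B>0 (N*edges≡ (suc e) e (sym (suc-*-binomial m e)))

    ∸-*-g : ℕ→ℚ (m ℕ.∸ e) * g (suc e) ≡ T₂ ÷ℕ (N ℕ.* B)
    ∸-*-g = scaled (m ℕ.∸ e) refl
      where
      scaled : ∀ c → c ≡ m ℕ.∸ e → ℕ→ℚ c * g (suc e) ≡ T₂ ÷ℕ (N ℕ.* B)
      scaled zero    0≡m∸e = begin
        0ℚ * g (suc e)      ≡⟨ *-zeroˡ (g (suc e)) ⟩
        0ℚ                  ≡⟨ *-zeroˡ (recip (N ℕ.* B)) ⟨
        0 ÷ℕ (N ℕ.* B)      ≡⟨ cong (_÷ℕ (N ℕ.* B)) (binomialTail-> {n} (s≤s (s≤s (ℕ.m∸n≡0⇒m≤n {m} {e} (sym 0≡m∸e))))) ⟨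
        T₂ ÷ℕ (N ℕ.* B)     ∎
      scaled (suc c) 1+c≡m∸e = *-÷ℕ (suc c) T₂ (s≤s z≤n) N*B>0
        (N*edges≡ (suc c) (suc e) (trans (sym (∸-*-binomial e≤m)) (cong (ℕ._* B) (sym 1+c≡m∸e))))

    Q-kirchhoff-suc : ℕ→ℚ n * Q (suc e) - neighbourSum n Q (suc e) ≡ 1 ÷ℕ N
    Q-kirchhoff-suc = begin
      ℕ→ℚ n * (Q e + g e) - (ℕ→ℚ (suc e) * Q e + ℕ→ℚ (m ℕ.∸ e) * ((Q e + g e) + g (suc e)))
        ≡⟨ cong (λ x → x * (Q e + g e) - neighbourSum n Q (suc e)) n≡suc-e+m∸e ⟩
      (ℕ→ℚ (suc e) + ℕ→ℚ (m ℕ.∸ e)) * (Q e + g e) - (ℕ→ℚ (suc e) * Q e + ℕ→ℚ (m ℕ.∸ e) * ((Q e + g e) + g (suc e)))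
        ≡⟨ solve 5 (λ a b q x y → (a :+ b) :* (q :+ x) :- (a :* q :+ b :* ((q :+ x) :+ y)) := a :* x :- b :* y) refl
             (ℕ→ℚ (suc e)) (ℕ→ℚ (m ℕ.∸ e)) (Q e) (g e) (g (suc e)) ⟩
      ℕ→ℚ (suc e) * g e - ℕ→ℚ (m ℕ.∸ e) * g (suc e)
        ≡⟨ cong₂ _-_ suc-*-g ∸-*-g ⟩
      ℕ→ℚ T₁ * recip (N ℕ.* B) - ℕ→ℚ T₂ * recip (N ℕ.* B)
        ≡⟨ cong (λ x → x * recip (N ℕ.* B) - ℕ→ℚ T₂ * recip (N ℕ.* B)) T₁≡B+T₂ ⟩
      (ℕ→ℚ B + ℕ→ℚ T₂) * recip (N ℕ.* B) - ℕ→ℚ T₂ * recip (N ℕ.* B)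
        ≡⟨ solve 3 (λ b t r → (b :+ t) :* r :- t :* r := b :* (con 1ℚ :* r)) refl (ℕ→ℚ B) (ℕ→ℚ T₂) (recip (N ℕ.* B)) ⟩
      ℕ→ℚ B * (1 ÷ℕ (N ℕ.* B))
        ≡⟨ *-÷ℕ B 1 B>0 N>0 (ℕ.*-comm N B) ⟩
      1 ÷ℕ N ∎
      where
      n≡suc-e+m∸e : ℕ→ℚ n ≡ ℕ→ℚ (suc e) + ℕ→ℚ (m ℕ.∸ e)
      n≡suc-e+m∸e = trans (cong (ℕ→ℚ ∘ suc) (sym (ℕ.m+[n∸m]≡n e≤m))) (ℕ→ℚ-+ (suc e) (m ℕ.∸ e))
      T₁≡B+T₂ : ℕ→ℚ T₁ ≡ ℕ→ℚ B + ℕ→ℚ T₂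
      T₁≡B+T₂ = trans (cong ℕ→ℚ (binomialTail-suc (s≤s e≤m))) (ℕ→ℚ-+ B T₂)

  Q-kirchhoff : ∀ d → d ℕ.≤ n → ℕ→ℚ n * Q d - neighbourSum n Q d ≡ 1 ÷ℕ N - δ₀ d
  Q-kirchhoff zero    _         = Q-kirchhoff-0
  Q-kirchhoff (suc e) (s≤s e≤m) = trans (Q-kirchhoff-suc e≤m) (sym (+-identityʳ (1 ÷ℕ N)))

  σ : Vertex n → Vertex n → ℚ
  σ u w = Q (hamming w u)

  Δσ : ∀ u w → Δ (σ u) w ≡ 1 ÷ℕ N - δ₀ (hamming w u)
  Δσ u w = trans (Δ-radial Q u w) (Q-kirchhoff (hamming w u) (hamming-≤ w u))

  σ-unitFlow : ∀ u v → IsUnitFlowPotential n u v (λ w → σ v w - σ u w)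
  σ-unitFlow u v w = begin
    outCurrent (λ x → σ v x - σ u x) w
      ≡⟨ outCurrent≡Δ (λ x → σ v x - σ u x) w ⟩
    Δ (λ x → σ v x - σ u x) w
      ≡⟨ Δ-distrib-- (σ v) (σ u) w ⟩
    Δ (σ v) w - Δ (σ u) w
      ≡⟨ cong₂ _-_ (Δσ v w) (Δσ u w) ⟩
    (1 ÷ℕ N - δ₀ (hamming w v)) - (1 ÷ℕ N - δ₀ (hamming w u))
      ≡⟨ solve 3 (λ c a b → (c :- b) :- (c :- a) := a :- b) refl (1 ÷ℕ N) (δ₀ (hamming w u)) (δ₀ (hamming w v)) ⟩
    δ₀ (hamming w u) - δ₀ (hamming w v)
      ≡⟨ cong₂ _-_ (indicator≡δ₀∘hamming w u) (indicator≡δ₀∘hamming w v) ⟨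
    indicator w u - indicator w v ∎

  R : ℕ → ℚ
  R d = Q d + Q d

  isEffRes-R : ∀ u v → IsEffRes n u v (R (hamming u v))
  isEffRes-R u v = (λ w → σ v w - σ u w) , σ-unitFlow u v , (begin
    Q (hamming u v) + Q (hamming u v)
      ≡⟨ solve 1 (λ q → q :+ q := (q :- con 0ℚ) :- (con 0ℚ :- q)) refl (Q (hamming u v)) ⟩
    (Q (hamming u v) - 0ℚ) - (0ℚ - Q (hamming u v))
      ≡⟨ cong₂ (λ x y → (Q (hamming u v) - Q x) - (Q y - Q (hamming u v))) (sym (hamming-refl u)) (sym (hamming-refl v)) ⟩
    (Q (hamming u v) - Q (hamming u u)) - (Q (hamming v v) - Q (hamming u v))
      ≡⟨ cong (λ x → (Q (hamming u v) - Q (hamming u u)) - (Q (hamming v v) - Q x)) (hamming-sym u v) ⟩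
    (σ v u - σ u u) - (σ v v - σ u v) ∎)

  R[1+j]-R[j]≡g[j]+g[j] : ∀ j → R (suc j) - R j ≡ g j + g j
  R[1+j]-R[j]≡g[j]+g[j] j = solve 2 (λ q x → ((q :+ x) :+ (q :+ x)) :- (q :+ q) := x :+ x) refl (Q j) (g j)

  g-closedForm : ∀ {j} → j ℕ.≤ m →
    (g j + g j) * ℕ→ℚ (diffDenominator n (suc j)) ≡ ℕ→ℚ (tailBinomSum n (suc j))
  g-closedForm {j} j≤m = begin
    (g j + g j) * ℕ→ℚ (n ℕ.* 2 ^ m ℕ.* (m C j))
      ≡⟨ cong₂ _*_ (solve 1 (λ x → x :+ x := (con 1ℚ :+ con 1ℚ) :* x) refl (g j)) (cong ℕ→ℚ D≡Y) ⟩
    (ℕ→ℚ 2 * g j) * ℕ→ℚ Y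
      ≡⟨ cong (_* ℕ→ℚ Y) (*-÷ℕ 2 T (s≤s z≤n) Y>0 (ℕ.*-assoc 2 (2 ^ m) (edges j))) ⟩
    (T ÷ℕ Y) * ℕ→ℚ Y
      ≡⟨ ÷ℕ-*-cancel T Y>0 ⟩
    ℕ→ℚ T
      ≡⟨ cong ℕ→ℚ (tailBinomSum≡binomialTail n (suc j)) ⟨
    ℕ→ℚ (tailBinomSum n (suc j)) ∎
    where
    T = binomialTail n (suc j)
    Y = 2 ^ m ℕ.* edges j
    Y>0 : 0 ℕ.< Y
    Y>0 = m*n>0 (ℕ.m^n>0 2 m) (m*n>0 {n} (s≤s z≤n) (binomial>0 j≤m))
    D≡Y : n ℕ.* 2 ^ m ℕ.* (m C j) ≡ Y
    D≡Y = begin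
      n ℕ.* 2 ^ m ℕ.* (m C j)        ≡⟨ cong (n ℕ.* 2 ^ m ℕ.*_) (binomial≡C m j) ⟨
      n ℕ.* 2 ^ m ℕ.* binomial m j   ≡⟨ ℕ.*-assoc n (2 ^ m) (binomial m j) ⟩
      n ℕ.* (2 ^ m ℕ.* binomial m j) ≡⟨ x∙yz≈y∙xz n (2 ^ m) (binomial m j) ⟩
      Y                              ∎

mainTheorem9 : (n k : ℕ) → 1 ℕ.≤ n → 1 ℕ.≤ k → k ℕ.≤ n →
    (u v u′ v′ : Vertex n) → hamming u v ≡ k → hamming u′ v′ ≡ k ℕ.∸ 1 →
    Σ ℚ (IsEffRes n u v) × Σ ℚ (IsEffRes n u′ v′) ×
    ((r r′ : ℚ) → IsEffRes n u v r → IsEffRes n u′ v′ r′ →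
      (0ℚ < r - r′) × ((r - r′) * ℕ→ℚ (diffDenominator n k) ≡ ℕ→ℚ (tailBinomSum n k)))
mainTheorem9 (suc m) (suc j) _ _ (s≤s j≤m) u v u′ v′ d≡1+j d′≡j =
  (_ , isEffRes-R u v) , (_ , isEffRes-R u′ v′) , λ r r′ isR isR′ →
    let r-r′≡2g : r - r′ ≡ g j + g j
        r-r′≡2g = trans (cong₂ _-_ (R-at isR d≡1+j) (R-at isR′ d′≡j)) (R[1+j]-R[j]≡g[j]+g[j] j)
    in subst (0ℚ <_) (sym r-r′≡2g) (+-mono-< (g>0 j≤m) (g>0 j≤m))
     , trans (cong (_* ℕ→ℚ (diffDenominator (suc m) (suc j))) r-r′≡2g) (g-closedForm j≤m)
  where
  open HypercubePotential m
  R-at : ∀ {x y r d} → IsEffRes (suc m) x y r → hamming x y ≡ d → r ≡ R d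
  R-at isR refl = isEffRes-unique isR (isEffRes-R _ _)
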